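{- Assume the Inverse Shortcode Hypothesis (ISH): for every $\eta>0$ there exist $\delta>0$ and an integer $r$, depending only on $\eta$, such that for all $\ell,n$ and every $S\subseteq\mathsf{Mat}_{\ell,n}$ with $\Pr_{M\sim S,\,a\sim\mathbb{F}_2^{\ell},\,b\sim\mathbb{F}_2^{n}}[M+ab^{\top}\in S]\ge\eta$, there is an $r$-nice set $T\subseteq\mathsf{Mat}_{\ell,n}$ with $|S\cap T|\ge\delta|T|$. Then the Unique Shortcode Soundness Hypothesis (USH) holds: for every $\eta>0$ there exist $\delta>0$ and an integer $r>0$ such that for sufficiently large $n\gg\ell$, every $F:\mathsf{Mat}_{\ell,n}\to\mathbb{F}_2^{\ell}$ with $\Pr_{M\sim\mathsf{Mat}_{\ell,n},\,a\sim\mathbb{F}_2^{\ell},\,b\sim\mathbb{F}_2^{n}}[F(M+ab^{\top})=F(M)]\ge\eta$ admits $q_1,\dots,q_r\in\mathbb{F}_2^n$, $t_1,\dots,t_r\in\mathbb{F}_2^{\ell}$, $p_1,\dots,p_r\in\mathbb{F}_2^{\ell}$, $s_1,\dots,s_r\in\mathbb{F}_2^{n}$, $z\in\mathbb{F}_2^n$, $u\in\mathbb{F}_2^{\ell}$ with $\Pr_{M\sim\mathsf{Mat}_{\ell,n}}[F(M)=Mz+u\mid Mq_i=t_i,\ p_i^{\top}M=s_i^{\top}\ \forall i\le r]\ge\delta$.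
   Context: $\mathsf{Mat}_{\ell,n}$ denotes the set of all $\ell\times n$ matrices over $\mathbb{F}_2$; $x\sim X$ denotes a uniform sample, samples independent. A right affine subspace of $\mathsf{Mat}_{\ell,n}$ is a set $\{M: Mq_i=t_i,\ i\le r_1\}$ ($q_i\in\mathbb{F}_2^n$, $t_i\in\mathbb{F}_2^\ell$); a left affine subspace is a set $\{M: s_j^{\top}M=u_j^{\top},\ j\le r_2\}$ ($s_j\in\mathbb{F}_2^\ell$, $u_j\in\mathbb{F}_2^n$). A set is $r$-nice if it is the intersection of a right affine subspace with $r_1$ constraints and a left affine subspace with $r_2$ constraints, $r_1+r_2=r$.
   Formalization: The parameter η ranges over the positive rationals in both the Inverse Shortcode Hypothesis and the Unique Shortcode Soundness Hypothesis, and the constant δ is taken in the positive rationals. -}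

module Defs where

open import Data.Bool using (Bool; true; false; _∧_; _xor_; if_then_else_)
open import Data.Bool.Properties using () renaming (_≟_ to _≟B_)
open import Data.Nat using (ℕ; zero; suc; _+_; _*_; _^_; _≤_)
open import Data.Integer using (+_)
open import Data.List using (List; []; _∷_; [_]; map; concatMap; foldr)
open import Data.Vec using (Vec; []; _∷_; replicate; zipWith)
import Data.Vec as V
open import Data.Vec.Properties using (≡-dec)
open import Data.Product using (Σ; ∃; _×_; _,_)
open import Relation.Nullary.Decidable using (⌊_⌋)
open import Relation.Binary.PropositionalEquality using (_≡_)
open import Data.Rational using (ℚ; 0ℚ; _/_) renaming (_≤_ to _≤ℚ_; _<_ to _<ℚ_; _*_ to _*ℚ_)

-- 𝔽₂ is modelled by Bool (addition = xor, multiplication = ∧).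
F2 : Set
F2 = Bool

Vect : ℕ → Set
Vect n = Vec F2 n

-- ℓ × n matrices over 𝔽₂, stored as ℓ rows of length n
Mat : ℕ → ℕ → Set
Mat ℓ n = Vec (Vec F2 n) ℓ

allVec : {A : Set} → List A → (n : ℕ) → List (Vec A n)
allVec xs zero    = [ [] ]
allVec xs (suc n) = concatMap (λ x → map (x ∷_) (allVec xs n)) xs

allBools : List Bool
allBools = false ∷ true ∷ []

-- enumeration of 𝔽₂^n (each element exactly once)
allVects : (n : ℕ) → List (Vect n)
allVects n = allVec allBools n

-- enumeration of Mat_{ℓ,n} (each element exactly once)
allMats : (ℓ n : ℕ) → List (Mat ℓ n)
allMats ℓ n = allVec (allVects n) ℓ

count : {A : Set} → (A → Bool) → List A → ℕ
count p = foldr (λ x k → if p x then suc k else k) 0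

_+v_ : {n : ℕ} → Vect n → Vect n → Vect n
_+v_ = zipWith _xor_

zeroV : {n : ℕ} → Vect n
zeroV = replicate _ false

dot : {n : ℕ} → Vect n → Vect n → F2
dot x y = V.foldr _ _xor_ false (zipWith _∧_ x y)

_·v_ : {ℓ n : ℕ} → Mat ℓ n → Vect n → Vect ℓ
M ·v v = V.map (λ row → dot row v) M

_ᵀ·_ : {ℓ n : ℕ} → Vect ℓ → Mat ℓ n → Vect n
s ᵀ· M = V.foldr _ _+v_ zeroV (zipWith (λ si row → V.map (si ∧_) row) s M)

_+M_ : {ℓ n : ℕ} → Mat ℓ n → Mat ℓ n → Mat ℓ n
_+M_ = zipWith _+v_

outer : {ℓ n : ℕ} → Vect ℓ → Vect n → Mat ℓ n
outer a b = V.map (λ ai → V.map (ai ∧_) b) a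

_==v_ : {n : ℕ} → Vect n → Vect n → Bool
x ==v y = ⌊ ≡-dec _≟B_ x y ⌋

allB : {k : ℕ} → Vec Bool k → Bool
allB = V.foldr _ _∧_ true

toℚ : ℕ → ℚ
toℚ k = (+ k) / 1

-- Data describing an r-nice set in Mat_{ℓ,n}:
-- right constraints M qᵢ = tᵢ (i < r₁), left constraints sⱼᵀ M = uⱼᵀ (j < r₂), r₁ + r₂ = r.
record NiceData (ℓ n r : ℕ) : Set where
  field
    r₁ r₂ : ℕ
    sumEq : r₁ + r₂ ≡ r
    qs : Vec (Vect n) r₁
    ts : Vec (Vect ℓ) r₁
    ss : Vec (Vect ℓ) r₂
    us : Vec (Vect n) r₂

inNice : {ℓ n r : ℕ} → NiceData ℓ n r → Mat ℓ n → Bool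
inNice D M = allB (zipWith (λ q t → (M ·v q) ==v t) qs ts)
           ∧ allB (zipWith (λ s u → (s ᵀ· M) ==v u) ss us)
  where open NiceData D

card : {ℓ n : ℕ} → (Mat ℓ n → Bool) → ℕ
card {ℓ} {n} S = count S (allMats ℓ n)

shortcodeHits : {ℓ n : ℕ} → (Mat ℓ n → Bool) → ℕ
shortcodeHits {ℓ} {n} S =
  foldr _+_ 0 (map (λ M → if S M
                           then foldr _+_ 0 (map (λ a → count (λ b → S (M +M outer a b)) (allVects n)) (allVects ℓ))
                           else 0) (allMats ℓ n))

-- Pr_{M∼S,a,b}[M + a bᵀ ∈ S] ≥ η  is written  η · |S| · 2^ℓ · 2^n ≤ #hits  (with S ≠ ∅ so the
-- probability is defined); the conclusion requires the r-nice set T to be nonempty.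
ISH : Set
ISH = (η : ℚ) → 0ℚ <ℚ η →
  Σ ℚ λ δ → Σ ℕ λ r → (0ℚ <ℚ δ) ×
   ((ℓ n : ℕ) (S : Mat ℓ n → Bool) →
     1 ≤ card S →
     η *ℚ toℚ (card S * 2 ^ ℓ * 2 ^ n) ≤ℚ toℚ (shortcodeHits S) →
     Σ (NiceData ℓ n r) λ T →
       (1 ≤ card (inNice T)) ×
       (δ *ℚ toℚ (card (inNice T)) ≤ℚ toℚ (card (λ M → S M ∧ inNice T M))))

agreeCount : {ℓ n : ℕ} → (Mat ℓ n → Vect ℓ) → ℕ
agreeCount {ℓ} {n} F =
  foldr _+_ 0 (map (λ M →
    foldr _+_ 0 (map (λ a → count (λ b → F (M +M outer a b) ==v F M) (allVects n)) (allVects ℓ)))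
    (allMats ℓ n))

condEvent : {ℓ n r : ℕ} → Vec (Vect n) r → Vec (Vect ℓ) r → Vec (Vect ℓ) r → Vec (Vect n) r →
            Mat ℓ n → Bool
condEvent qs ts ps ss M =
  allB (zipWith (λ q t → (M ·v q) ==v t) qs ts) ∧ allB (zipWith (λ p s → (p ᵀ· M) ==v s) ps ss)

-- Unique Shortcode Soundness Hypothesis.
-- "for sufficiently large n ≫ ℓ" : there is a threshold function N (depending on η) with n ≥ N ℓ.
-- The conditional probability is written  δ · #C ≤ #(C ∧ F(M) = Mz+u)  with #C ≥ 1 (C nonempty).
USH : Set
USH = (η : ℚ) → 0ℚ <ℚ η →
  Σ ℚ λ δ → Σ ℕ λ r → (0ℚ <ℚ δ) × (1 ≤ r) ×
   Σ (ℕ → ℕ) λ N →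
   ((ℓ n : ℕ) → N ℓ ≤ n → (F : Mat ℓ n → Vect ℓ) →
     η *ℚ toℚ (2 ^ (ℓ * n) * 2 ^ ℓ * 2 ^ n) ≤ℚ toℚ (agreeCount F) →
     Σ (Vec (Vect n) r) λ qs → Σ (Vec (Vect ℓ) r) λ ts →
     Σ (Vec (Vect ℓ) r) λ ps → Σ (Vec (Vect n) r) λ ss →
     Σ (Vect n) λ z → Σ (Vect ℓ) λ u →
       (1 ≤ card (condEvent qs ts ps ss)) ×
       (δ *ℚ toℚ (card (condEvent qs ts ps ss))
          ≤ℚ toℚ (card (λ M → condEvent qs ts ps ss M ∧ (F M ==v ((M ·v z) +v u))))))

-- Encode F by its graph S = {(y | M) : y = F M} ⊆ Mat ℓ (n + 1), with y the first column.  S has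
-- 2^(ℓn) elements, and every agreeing triple (M, a, b) of F gives the shortcode step (a, (0, b)) from
-- (F M | M) that stays in S, so S passes the test of ISH with η/2.  ISH then yields a nice T with
-- |S ∩ T| ≥ δ |T|.  If some right constraint of T involves the first column, that column equals an
-- affine function M z + u of the others on all of T; so T is a nice set T′ of M's and S ∩ T is
-- exactly {M ∈ T′ : F M = M z + u}.  Otherwise T = T′ × C for a set C of first columns, and
-- |S ∩ T| = Σ_{y ∈ C} |{M ∈ T′ : F M = y}| ≤ |C| · max_y |{M ∈ T′ : F M = y}|, so the most popular
-- value u of F on T′ works with z = 0.  Trivial constraints pad T′ to r + 1 right and left ones.

module Submission where

open import Algebra.Bundles using (CommutativeMonoid; CommutativeRing)
open import Data.Bool using (Bool; true; false; _∧_; _xor_; if_then_else_)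
open import Data.Bool.Properties
  using (∧-assoc; ∧-comm; ∧-identityʳ; ∧-zeroʳ; ∧-conicalˡ; ∧-conicalʳ; ∧-distribˡ-xor; ∧-commutativeMonoid;
         xor-assoc; xor-comm; xor-identityʳ; xor-same; xor-∧-commutativeRing)
  renaming (_≟_ to _≟B_)
open import Data.Fin using (Fin; zero; suc)
import Data.Integer as ℤ
open import Data.Integer using (+≤+; +<+)
import Data.Integer.Properties as ℤ
open import Data.List using (List; []; _∷_; map; concatMap; _++_; length)
open import Data.List.Extrema.Nat using (argmax; f[xs]≤f[argmax])
import Data.List.Properties as List
open import Data.List.Relation.Unary.All as All using (All; []; _∷_)
open import Data.Nat using (ℕ; zero; suc; _+_; _*_; _^_; _≤_; z≤n; s≤s; >-nonZero; >-nonZero⁻¹)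
open import Data.Nat.ListAction using (sum)
open import Data.Nat.ListAction.Properties using (sum-++)
open import Data.Nat.Properties
  using (module ≤-Reasoning; ≤-trans; ≤-reflexive; +-identityʳ; +-mono-≤; m≤m+n; *-comm; *-zeroʳ;
         *-distribˡ-+; *-monoʳ-≤; ^-*-assoc; m^n>0; m*n≢0⇒m≢0; m*n≢0⇒n≢0;
         +-commutativeSemigroup; *-commutativeSemigroup)
open import Data.Product using (Σ; _×_; _,_; proj₁; proj₂)
open import Data.Rational using (ℚ; 0ℚ; 1ℚ; ½; toℚᵘ; Positive; positive)
  renaming (_≤_ to _≤ℚ_; _<_ to _<ℚ_; _*_ to _*ℚ_)
import Data.Rational.Properties as ℚ
open import Data.Rational.Unnormalised using (mkℚᵘ; *≡*; *≤*; *<*) renaming (_≃_ to _≃ᵘ_; _*_ to _*ᵘ_)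
import Data.Rational.Unnormalised.Properties as ℚᵘ
open import Data.Sum using (_⊎_; inj₁; inj₂)
open import Data.Vec using (Vec; []; _∷_)
import Data.Vec as Vec
import Data.Vec.Properties as Vec
open import Data.Vec.Properties using (≡-dec)
import Data.Vec.Relation.Unary.All as VecAll
open import Relation.Binary.PropositionalEquality
open import Relation.Nullary using (yes; no; contradiction)
open import Relation.Nullary.Decidable using (⌊_⌋)

open import Algebra.Properties.CommutativeSemigroup +-commutativeSemigroup using (interchange)
open import Algebra.Properties.CommutativeSemigroup *-commutativeSemigroup
  using () renaming (x∙yz≈y∙xz to *-left-commute)
open import Algebra.Properties.CommutativeSemigroup (CommutativeMonoid.commutativeSemigroup ∧-commutativeMonoid)
  using (x∙yz≈xz∙y) renaming (interchange to ∧-interchange)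
open import Algebra.Properties.CommutativeSemigroup (CommutativeRing.+-commutativeSemigroup xor-∧-commutativeRing)
  using () renaming (interchange to xor-interchange)

open import Defs

private
  variable
    A B : Set

private
  toℚᵘ-toℚ : ∀ k → toℚᵘ (toℚ k) ≃ᵘ mkℚᵘ (ℤ.+ k) 0
  toℚᵘ-toℚ k = ℚ.toℚᵘ-fromℚᵘ (mkℚᵘ (ℤ.+ k) 0)

toℚ-* : ∀ m n → toℚ (m * n) ≡ toℚ m *ℚ toℚ n
toℚ-* m n = ℚ.toℚᵘ-injective (begin
  toℚᵘ (toℚ (m * n))               ≈⟨ toℚᵘ-toℚ (m * n) ⟩
  mkℚᵘ (ℤ.+ (m * n)) 0             ≈⟨ *≡* (cong (ℤ._* ℤ.+ 1) (ℤ.pos-* m n)) ⟩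
  mkℚᵘ (ℤ.+ m) 0 *ᵘ mkℚᵘ (ℤ.+ n) 0 ≈⟨ ℚᵘ.*-cong (toℚᵘ-toℚ m) (toℚᵘ-toℚ n) ⟨
  toℚᵘ (toℚ m) *ᵘ toℚᵘ (toℚ n)     ≈⟨ ℚ.toℚᵘ-homo-* (toℚ m) (toℚ n) ⟨
  toℚᵘ (toℚ m *ℚ toℚ n)            ∎)
  where open ℚᵘ.≃-Reasoning

toℚ-mono-≤ : ∀ {m n} → m ≤ n → toℚ m ≤ℚ toℚ n
toℚ-mono-≤ {m} {n} m≤n = ℚ.toℚᵘ-cancel-≤
  (ℚᵘ.≤-respˡ-≃ (ℚᵘ.≃-sym (toℚᵘ-toℚ m)) (ℚᵘ.≤-respʳ-≃ (ℚᵘ.≃-sym (toℚᵘ-toℚ n))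
    (*≤* (ℤ.*-monoʳ-≤-nonNeg (ℤ.+ 1) (+≤+ m≤n)))))

toℚ-positive : ∀ {n} → 1 ≤ n → Positive (toℚ n)
toℚ-positive {n} 1≤n = positive (ℚ.toℚᵘ-cancel-<
  (ℚᵘ.<-respˡ-≃ (ℚᵘ.≃-sym (toℚᵘ-toℚ 0)) (ℚᵘ.<-respʳ-≃ (ℚᵘ.≃-sym (toℚᵘ-toℚ n))
    (*<* (ℤ.*-monoʳ-<-pos (ℤ.+ 1) (+<+ 1≤n))))))

*-cancelʳ-≤-toℚ : ∀ δ c k m → 1 ≤ k →
                  δ *ℚ toℚ (c * k) ≤ℚ toℚ (k * m) → δ *ℚ toℚ c ≤ℚ toℚ m
*-cancelʳ-≤-toℚ δ c k m 1≤k δck≤km = ℚ.*-cancelʳ-≤-pos (toℚ k) {{toℚ-positive 1≤k}} (begin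
  δ *ℚ toℚ c *ℚ toℚ k    ≡⟨ ℚ.*-assoc δ (toℚ c) (toℚ k) ⟩
  δ *ℚ (toℚ c *ℚ toℚ k)  ≡⟨ cong (δ *ℚ_) (toℚ-* c k) ⟨
  δ *ℚ toℚ (c * k)       ≤⟨ δck≤km ⟩
  toℚ (k * m)            ≡⟨ cong toℚ (*-comm k m) ⟩
  toℚ (m * k)            ≡⟨ toℚ-* m k ⟩
  toℚ m *ℚ toℚ k         ∎)
  where open ℚ.≤-Reasoning

½-*-toℚ-double : ∀ η m → η *ℚ ½ *ℚ toℚ (2 * m) ≡ η *ℚ toℚ m
½-*-toℚ-double η m = begin
  η *ℚ ½ *ℚ toℚ (2 * m)          ≡⟨ cong (η *ℚ ½ *ℚ_) (toℚ-* 2 m) ⟩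
  η *ℚ ½ *ℚ (toℚ 2 *ℚ toℚ m)     ≡⟨ ℚ.*-assoc η ½ _ ⟩
  η *ℚ (½ *ℚ (toℚ 2 *ℚ toℚ m))   ≡⟨ cong (η *ℚ_) (ℚ.*-assoc ½ (toℚ 2) (toℚ m)) ⟨
  η *ℚ (½ *ℚ toℚ 2 *ℚ toℚ m)     ≡⟨⟩
  η *ℚ (1ℚ *ℚ toℚ m)             ≡⟨ cong (η *ℚ_) (ℚ.*-identityˡ (toℚ m)) ⟩
  η *ℚ toℚ m                     ∎
  where open ≡-Reasoning

*½-positive : ∀ {η} → 0ℚ <ℚ η → 0ℚ <ℚ η *ℚ ½
*½-positive {η} η>0 = ℚ.positive⁻¹ (η *ℚ ½) {{ℚ.pos*pos⇒pos η {{positive η>0}} ½}}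

1≤*⇒1≤ˡ : ∀ m n → 1 ≤ m * n → 1 ≤ m
1≤*⇒1≤ˡ m n 1≤mn = >-nonZero⁻¹ m {{m*n≢0⇒m≢0 m {{>-nonZero 1≤mn}}}}

1≤*⇒1≤ʳ : ∀ m n → 1 ≤ m * n → 1 ≤ n
1≤*⇒1≤ʳ m n 1≤mn = >-nonZero⁻¹ n {{m*n≢0⇒n≢0 m {{>-nonZero 1≤mn}}}}

∑ : List A → (A → ℕ) → ℕ
∑ xs f = sum (map f xs)

𝟙 : Bool → ℕ
𝟙 b = if b then 1 else 0

count≡∑𝟙 : (p : A → Bool) (xs : List A) → count p xs ≡ ∑ xs (λ x → 𝟙 (p x))
count≡∑𝟙 p []       = refl
count≡∑𝟙 p (x ∷ xs) with p x
... | true  = cong suc (count≡∑𝟙 p xs)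
... | false = count≡∑𝟙 p xs

∑-cong : {f g : A → ℕ} (xs : List A) → (∀ x → f x ≡ g x) → ∑ xs f ≡ ∑ xs g
∑-cong xs f≗g = cong sum (List.map-cong f≗g xs)

∑-mono : {f g : A → ℕ} {xs : List A} → All (λ x → f x ≤ g x) xs → ∑ xs f ≤ ∑ xs g
∑-mono []                = z≤n
∑-mono (fx≤gx ∷ fxs≤gxs) = +-mono-≤ fx≤gx (∑-mono fxs≤gxs)

∑-map : (f : B → ℕ) (g : A → B) (xs : List A) → ∑ (map g xs) f ≡ ∑ xs (λ x → f (g x))
∑-map f g xs = cong sum (sym (List.map-∘ xs))

∑-concatMap : (f : B → ℕ) (g : A → List B) (xs : List A) →
              ∑ (concatMap g xs) f ≡ ∑ xs (λ x → ∑ (g x) f)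
∑-concatMap f g []       = refl
∑-concatMap f g (x ∷ xs) = begin
  ∑ (g x ++ concatMap g xs) f                  ≡⟨ cong sum (List.map-++ f (g x) (concatMap g xs)) ⟩
  sum (map f (g x) ++ map f (concatMap g xs))  ≡⟨ sum-++ (map f (g x)) _ ⟩
  ∑ (g x) f + ∑ (concatMap g xs) f             ≡⟨ cong (∑ (g x) f +_) (∑-concatMap f g xs) ⟩
  ∑ (g x) f + ∑ xs (λ x → ∑ (g x) f)           ∎
  where open ≡-Reasoning

∑-+ : (f g : A → ℕ) (xs : List A) → ∑ xs (λ x → f x + g x) ≡ ∑ xs f + ∑ xs g
∑-+ f g []       = refl
∑-+ f g (x ∷ xs) = trans (cong (f x + g x +_) (∑-+ f g xs)) (interchange (f x) (g x) _ _)

∑-*ˡ : (c : ℕ) (f : A → ℕ) (xs : List A) → ∑ xs (λ x → c * f x) ≡ c * ∑ xs f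
∑-*ˡ c f []       = sym (*-zeroʳ c)
∑-*ˡ c f (x ∷ xs) = trans (cong (c * f x +_) (∑-*ˡ c f xs)) (sym (*-distribˡ-+ c (f x) _))

∑-*ʳ : (c : ℕ) (f : A → ℕ) (xs : List A) → ∑ xs (λ x → f x * c) ≡ ∑ xs f * c
∑-*ʳ c f xs = trans (∑-cong xs (λ x → *-comm (f x) c)) (trans (∑-*ˡ c f xs) (*-comm c _))

∑-const : (c : ℕ) (xs : List A) → ∑ xs (λ _ → c) ≡ length xs * c
∑-const c []       = refl
∑-const c (x ∷ xs) = cong (c +_) (∑-const c xs)

∑-zero : (xs : List A) → ∑ xs (λ _ → 0) ≡ 0
∑-zero xs = trans (∑-const 0 xs) (*-zeroʳ (length xs))

∑-swap : (f : A → B → ℕ) (xs : List A) (ys : List B) →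
         ∑ xs (λ x → ∑ ys (f x)) ≡ ∑ ys (λ y → ∑ xs (λ x → f x y))
∑-swap f []       ys = sym (∑-zero ys)
∑-swap f (x ∷ xs) ys = trans (cong (∑ ys (f x) +_) (∑-swap f xs ys))
                             (sym (∑-+ (f x) (λ y → ∑ xs (λ x′ → f x′ y)) ys))

∑-1≡length : (xs : List A) → ∑ xs (λ _ → 1) ≡ length xs
∑-1≡length []       = refl
∑-1≡length (x ∷ xs) = cong suc (∑-1≡length xs)

∑-allVec-suc : {n : ℕ} (f : Vec A (suc n) → ℕ) (xs : List A) →
               ∑ (allVec xs (suc n)) f ≡ ∑ xs (λ x → ∑ (allVec xs n) (λ v → f (x ∷ v)))
∑-allVec-suc {n = n} f xs = trans (∑-concatMap f (λ x → map (x ∷_) (allVec xs n)) xs)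
                              (∑-cong xs (λ x → ∑-map f (x ∷_) (allVec xs n)))

length-allVec : (xs : List A) (n : ℕ) → length (allVec xs n) ≡ length xs ^ n
length-allVec xs zero    = refl
length-allVec xs (suc n) = begin
  length (allVec xs (suc n))              ≡⟨ ∑-1≡length (allVec xs (suc n)) ⟨
  ∑ (allVec xs (suc n)) (λ _ → 1)         ≡⟨ ∑-allVec-suc (λ _ → 1) xs ⟩
  ∑ xs (λ _ → ∑ (allVec xs n) (λ _ → 1))  ≡⟨ ∑-cong xs (λ _ → ∑-1≡length (allVec xs n)) ⟩
  ∑ xs (λ _ → length (allVec xs n))       ≡⟨ ∑-cong xs (λ _ → length-allVec xs n) ⟩
  ∑ xs (λ _ → length xs ^ n)              ≡⟨ ∑-const (length xs ^ n) xs ⟩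
  length xs * length xs ^ n               ∎
  where open ≡-Reasoning

𝟙-∧ : ∀ a b → 𝟙 (a ∧ b) ≡ (if a then 𝟙 b else 0)
𝟙-∧ false b = refl
𝟙-∧ true  b = refl

𝟙-∧-* : ∀ a b → 𝟙 (a ∧ b) ≡ 𝟙 a * 𝟙 b
𝟙-∧-* false b     = refl
𝟙-∧-* true  false = refl
𝟙-∧-* true  true  = refl

if-𝟙-∧ : ∀ a b c → (if c then 𝟙 (a ∧ b) else 0) ≡ 𝟙 b * 𝟙 (a ∧ c)
if-𝟙-∧ false false false = refl
if-𝟙-∧ false false true  = refl
if-𝟙-∧ false true  false = refl
if-𝟙-∧ false true  true  = refl
if-𝟙-∧ true  false false = refl
if-𝟙-∧ true  false true  = refl
if-𝟙-∧ true  true  false = refl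
if-𝟙-∧ true  true  true  = refl

==v-refl : ∀ {n} (x : Vect n) → x ==v x ≡ true
==v-refl x with ≡-dec _≟B_ x x
... | yes _  = refl
... | no x≢x = contradiction refl x≢x

==v⇒≡ : ∀ {n} {x y : Vect n} → x ==v y ≡ true → x ≡ y
==v⇒≡ {x = x} {y} x==y with ≡-dec _≟B_ x y
... | yes x≡y = x≡y

==v-⇔ : ∀ {m n} {x y : Vect m} {x′ y′ : Vect n} →
        (x ≡ y → x′ ≡ y′) → (x′ ≡ y′ → x ≡ y) → x ==v y ≡ x′ ==v y′
==v-⇔ {x = x} {y} {x′} {y′} to from with ≡-dec _≟B_ x y | ≡-dec _≟B_ x′ y′
... | yes _   | yes _    = refl
... | yes x≡y | no x′≢y′ = contradiction (to x≡y) x′≢y′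
... | no x≢y  | yes x′≡y′ = contradiction (from x′≡y′) x≢y
... | no _    | no _     = refl

==v-sym : ∀ {n} (x y : Vect n) → x ==v y ≡ y ==v x
==v-sym x y = ==v-⇔ sym sym

==v-∷ : ∀ {n} (a b : Bool) (x y : Vect n) → (a ∷ x) ==v (b ∷ y) ≡ ⌊ a ≟B b ⌋ ∧ (x ==v y)
==v-∷ a b x y with a ≟B b | ≡-dec _≟B_ x y
... | yes _ | yes _ = refl
... | yes _ | no _  = refl
... | no _  | _     = refl

∑-==v : ∀ ℓ (v : Vect ℓ) (h : Vect ℓ → ℕ) →
        ∑ (allVects ℓ) (λ y → if v ==v y then h y else 0) ≡ h v
∑-==v zero    []      h = +-identityʳ (h [])
∑-==v (suc ℓ) (b ∷ v) h = begin
  ∑ (allVects (suc ℓ)) (λ y → if (b ∷ v) ==v y then h y else 0)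
    ≡⟨ ∑-allVec-suc (λ y → if (b ∷ v) ==v y then h y else 0) allBools ⟩
  ∑ allBools (λ x → ∑ (allVects ℓ) (λ y → if (b ∷ v) ==v (x ∷ y) then h (x ∷ y) else 0))
    ≡⟨ ∑-cong allBools (λ x → ∑-cong (allVects ℓ) (λ y →
         cong (λ c → if c then h (x ∷ y) else 0) (==v-∷ b x v y))) ⟩
  ∑ allBools (λ x → ∑ (allVects ℓ) (λ y → if ⌊ b ≟B x ⌋ ∧ (v ==v y) then h (x ∷ y) else 0))
    ≡⟨ select b ⟩
  h (b ∷ v) ∎
  where
  open ≡-Reasoning
  select : ∀ c → ∑ allBools (λ x → ∑ (allVects ℓ) (λ y → if ⌊ c ≟B x ⌋ ∧ (v ==v y) then h (x ∷ y) else 0))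
                 ≡ h (c ∷ v)
  select false = trans (cong₂ _+_ (∑-==v ℓ v (λ y → h (false ∷ y))) (+-identityʳ _))
                       (trans (cong (h (false ∷ v) +_) (∑-zero (allVects ℓ))) (+-identityʳ _))
  select true  = cong₂ _+_ (∑-zero (allVects ℓ)) (trans (+-identityʳ _) (∑-==v ℓ v (λ y → h (true ∷ y))))

-- Linear algebra over 𝔽₂

+v-comm : ∀ {n} (x y : Vect n) → x +v y ≡ y +v x
+v-comm = Vec.zipWith-comm xor-comm

+v-assoc : ∀ {n} (x y z : Vect n) → (x +v y) +v z ≡ x +v (y +v z)
+v-assoc = Vec.zipWith-assoc xor-assoc

+v-identityʳ : ∀ {n} (x : Vect n) → x +v zeroV ≡ x
+v-identityʳ = Vec.zipWith-identityʳ xor-identityʳ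

+v-self : ∀ {n} (x : Vect n) → x +v x ≡ zeroV
+v-self []       = refl
+v-self (a ∷ x) = cong₂ _∷_ (xor-same a) (+v-self x)

+v-involutiveʳ : ∀ {n} (x u : Vect n) → (x +v u) +v u ≡ x
+v-involutiveʳ x u = trans (+v-assoc x u u) (trans (cong (x +v_) (+v-self u)) (+v-identityʳ x))

+v-transposeʳ : ∀ {n} {x u t : Vect n} → x +v u ≡ t → x ≡ t +v u
+v-transposeʳ {x = x} {u} x+u≡t = trans (sym (+v-involutiveʳ x u)) (cong (_+v u) x+u≡t)

+v-rotate : ∀ {n} (a u b : Vect n) → (a +v u) +v b ≡ (b +v a) +v u
+v-rotate a u b = begin
  (a +v u) +v b   ≡⟨ +v-assoc a u b ⟩
  a +v (u +v b)   ≡⟨ cong (a +v_) (+v-comm u b) ⟩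
  a +v (b +v u)   ≡⟨ +v-assoc a b u ⟨
  (a +v b) +v u   ≡⟨ cong (_+v u) (+v-comm a b) ⟩
  (b +v a) +v u   ∎
  where open ≡-Reasoning

dot-comm : ∀ {n} (x y : Vect n) → dot x y ≡ dot y x
dot-comm []       []       = refl
dot-comm (a ∷ x) (b ∷ y) = cong₂ _xor_ (∧-comm a b) (dot-comm x y)

dot-+vʳ : ∀ {n} (s x y : Vect n) → dot s (x +v y) ≡ dot s x xor dot s y
dot-+vʳ []      []      []      = refl
dot-+vʳ (c ∷ s) (a ∷ x) (b ∷ y) =
  trans (cong₂ _xor_ (∧-distribˡ-xor c a b) (dot-+vʳ s x y))
        (xor-interchange (c ∧ a) (c ∧ b) (dot s x) (dot s y))

dot-+vˡ : ∀ {n} (x y z : Vect n) → dot (x +v y) z ≡ dot x z xor dot y z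
dot-+vˡ x y z = begin
  dot (x +v y) z          ≡⟨ dot-comm (x +v y) z ⟩
  dot z (x +v y)          ≡⟨ dot-+vʳ z x y ⟩
  dot z x xor dot z y     ≡⟨ cong₂ _xor_ (dot-comm z x) (dot-comm z y) ⟩
  dot x z xor dot y z     ∎
  where open ≡-Reasoning

dot-zeroʳ : ∀ {n} (s : Vect n) → dot s zeroV ≡ false
dot-zeroʳ []      = refl
dot-zeroʳ (c ∷ s) = cong₂ _xor_ (∧-zeroʳ c) (dot-zeroʳ s)

dot-map-∧ : ∀ {n} c (x z : Vect n) → dot (Vec.map (c ∧_) x) z ≡ c ∧ dot x z
dot-map-∧ false x z = trans (cong (λ v → dot v z) (Vec.map-const x false)) (trans (dot-comm zeroV z) (dot-zeroʳ z))
dot-map-∧ true  x z = cong (λ v → dot v z) (Vec.map-id x)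

·v-+v : ∀ {ℓ n} (M : Mat ℓ n) (x y : Vect n) → M ·v (x +v y) ≡ (M ·v x) +v (M ·v y)
·v-+v []      x y = refl
·v-+v (m ∷ M) x y = cong₂ _∷_ (dot-+vʳ m x y) (·v-+v M x y)

·v-zeroV : ∀ {ℓ n} (M : Mat ℓ n) → M ·v zeroV ≡ zeroV
·v-zeroV []      = refl
·v-zeroV (m ∷ M) = cong₂ _∷_ (dot-zeroʳ m) (·v-zeroV M)

zeroVᵀ· : ∀ {ℓ n} (M : Mat ℓ n) → zeroV ᵀ· M ≡ zeroV
zeroVᵀ· []      = refl
zeroVᵀ· (m ∷ M) = trans (cong₂ _+v_ (Vec.map-const m false) (zeroVᵀ· M)) (+v-self zeroV)

dot-ᵀ·-·v : ∀ {ℓ n} (s : Vect ℓ) (M : Mat ℓ n) (z : Vect n) → dot s (M ·v z) ≡ dot (s ᵀ· M) z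
dot-ᵀ·-·v []      []      z = sym (trans (dot-comm zeroV z) (dot-zeroʳ z))
dot-ᵀ·-·v (c ∷ s) (m ∷ M) z = begin
  (c ∧ dot m z) xor dot s (M ·v z)                   ≡⟨ cong₂ _xor_ (sym (dot-map-∧ c m z)) (dot-ᵀ·-·v s M z) ⟩
  dot (Vec.map (c ∧_) m) z xor dot (s ᵀ· M) z        ≡⟨ dot-+vˡ (Vec.map (c ∧_) m) (s ᵀ· M) z ⟨
  dot (Vec.map (c ∧_) m +v (s ᵀ· M)) z               ∎
  where open ≡-Reasoning

-- Matrices with a prepended first column

infixr 5 _⊲_

_⊲_ : ∀ {ℓ n} → Vect ℓ → Mat ℓ n → Mat ℓ (suc n)
_⊲_ = Vec.zipWith _∷_

map-head-⊲ : ∀ {ℓ n} (y : Vect ℓ) (M : Mat ℓ n) → Vec.map Vec.head (y ⊲ M) ≡ y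
map-head-⊲ []      []      = refl
map-head-⊲ (a ∷ y) (m ∷ M) = cong (a ∷_) (map-head-⊲ y M)

map-tail-⊲ : ∀ {ℓ n} (y : Vect ℓ) (M : Mat ℓ n) → Vec.map Vec.tail (y ⊲ M) ≡ M
map-tail-⊲ []      []      = refl
map-tail-⊲ (a ∷ y) (m ∷ M) = cong (m ∷_) (map-tail-⊲ y M)

⊲-·v-false : ∀ {ℓ n} (y : Vect ℓ) (M : Mat ℓ n) (q : Vect n) → (y ⊲ M) ·v (false ∷ q) ≡ M ·v q
⊲-·v-false []      []      q = refl
⊲-·v-false (a ∷ y) (m ∷ M) q = cong₂ _∷_ (cong (_xor dot m q) (∧-zeroʳ a)) (⊲-·v-false y M q)

⊲-·v-true : ∀ {ℓ n} (y : Vect ℓ) (M : Mat ℓ n) (q : Vect n) → (y ⊲ M) ·v (true ∷ q) ≡ y +v (M ·v q)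
⊲-·v-true []      []      q = refl
⊲-·v-true (a ∷ y) (m ∷ M) q = cong₂ _∷_ (cong (_xor dot m q) (∧-identityʳ a)) (⊲-·v-true y M q)

ᵀ·-⊲ : ∀ {ℓ n} (s y : Vect ℓ) (M : Mat ℓ n) → s ᵀ· (y ⊲ M) ≡ dot s y ∷ (s ᵀ· M)
ᵀ·-⊲ []      []      []      = refl
ᵀ·-⊲ (c ∷ s) (a ∷ y) (m ∷ M) = cong (Vec.map (c ∧_) (a ∷ m) +v_) (ᵀ·-⊲ s y M)

⊲-+M-outer : ∀ {ℓ n} (y a : Vect ℓ) (M : Mat ℓ n) (b : Vect n) →
             (y ⊲ M) +M outer a (false ∷ b) ≡ y ⊲ (M +M outer a b)
⊲-+M-outer []      []      []      b = refl
⊲-+M-outer (c ∷ y) (d ∷ a) (m ∷ M) b =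
  cong₂ _∷_ (cong (_∷ _) (trans (cong (c xor_) (∧-zeroʳ d)) (xor-identityʳ c))) (⊲-+M-outer y a M b)

∑-allMats-suc : ∀ ℓ n (f : Mat ℓ (suc n) → ℕ) →
                ∑ (allMats ℓ (suc n)) f ≡ ∑ (allMats ℓ n) (λ M → ∑ (allVects ℓ) (λ y → f (y ⊲ M)))
∑-allMats-suc zero    n f = sym (+-identityʳ _)
∑-allMats-suc (suc ℓ) n f = begin
  ∑ (allMats (suc ℓ) (suc n)) f
    ≡⟨ ∑-allVec-suc f (allVects (suc n)) ⟩
  ∑ (allVects (suc n)) (λ m′ → ∑ (allMats ℓ (suc n)) (λ M′ → f (m′ ∷ M′)))
    ≡⟨ ∑-allVec-suc (λ m′ → ∑ (allMats ℓ (suc n)) (λ M′ → f (m′ ∷ M′))) allBools ⟩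
  ∑ allBools (λ a → ∑ (allVects n) (λ m → ∑ (allMats ℓ (suc n)) (λ M′ → f ((a ∷ m) ∷ M′))))
    ≡⟨ ∑-cong allBools (λ a → ∑-cong (allVects n) (λ m → ∑-allMats-suc ℓ n (λ M′ → f ((a ∷ m) ∷ M′)))) ⟩
  ∑ allBools (λ a → ∑ (allVects n) (λ m → ∑ (allMats ℓ n) (λ M → ∑ (allVects ℓ) (g a m M))))
    ≡⟨ ∑-swap (λ a m → ∑ (allMats ℓ n) (λ M → ∑ (allVects ℓ) (g a m M))) allBools (allVects n) ⟩
  ∑ (allVects n) (λ m → ∑ allBools (λ a → ∑ (allMats ℓ n) (λ M → ∑ (allVects ℓ) (g a m M))))
    ≡⟨ ∑-cong (allVects n) (λ m → ∑-swap (λ a M → ∑ (allVects ℓ) (g a m M)) allBools (allMats ℓ n)) ⟩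
  ∑ (allVects n) (λ m → ∑ (allMats ℓ n) (λ M → ∑ allBools (λ a → ∑ (allVects ℓ) (g a m M))))
    ≡⟨ ∑-cong (allVects n) (λ m → ∑-cong (allMats ℓ n) (λ M → ∑-allVec-suc (λ y → f (y ⊲ (m ∷ M))) allBools)) ⟨
  ∑ (allVects n) (λ m → ∑ (allMats ℓ n) (λ M → ∑ (allVects (suc ℓ)) (λ y → f (y ⊲ (m ∷ M)))))
    ≡⟨ ∑-allVec-suc (λ M → ∑ (allVects (suc ℓ)) (λ y → f (y ⊲ M))) (allVects n) ⟨
  ∑ (allMats (suc ℓ) n) (λ M → ∑ (allVects (suc ℓ)) (λ y → f (y ⊲ M))) ∎
  where
  open ≡-Reasoning
  g : Bool → Vect n → Mat ℓ n → Vect ℓ → ℕ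
  g a m M y = f ((a ∷ y) ⊲ (m ∷ M))

card-⊲ : ∀ {ℓ n} (P : Mat ℓ (suc n) → Bool) →
         card P ≡ ∑ (allMats ℓ n) (λ M → ∑ (allVects ℓ) (λ y → 𝟙 (P (y ⊲ M))))
card-⊲ {ℓ} {n} P = trans (count≡∑𝟙 P (allMats ℓ (suc n))) (∑-allMats-suc ℓ n (λ M′ → 𝟙 (P M′)))

length-allMats : ∀ ℓ n → length (allMats ℓ n) ≡ 2 ^ (ℓ * n)
length-allMats ℓ n = begin
  length (allMats ℓ n)        ≡⟨ length-allVec (allVects n) ℓ ⟩
  length (allVects n) ^ ℓ     ≡⟨ cong (_^ ℓ) (length-allVec allBools n) ⟩
  (2 ^ n) ^ ℓ                 ≡⟨ ^-*-assoc 2 n ℓ ⟩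
  2 ^ (n * ℓ)                 ≡⟨ cong (2 ^_) (*-comm n ℓ) ⟩
  2 ^ (ℓ * n)                 ∎
  where open ≡-Reasoning

count-cong : {p q : A → Bool} (xs : List A) → (∀ x → p x ≡ q x) → count p xs ≡ count q xs
count-cong {p = p} {q} xs p≗q =
  trans (count≡∑𝟙 p xs) (trans (∑-cong xs (λ x → cong 𝟙 (p≗q x))) (sym (count≡∑𝟙 q xs)))

count-head-false≤count : ∀ {n} (p : Vect (suc n) → Bool) →
                         count (λ b → p (false ∷ b)) (allVects n) ≤ count p (allVects (suc n))
count-head-false≤count {n} p = begin
  count (λ b → p (false ∷ b)) (allVects n)          ≡⟨ count≡∑𝟙 (λ b → p (false ∷ b)) (allVects n) ⟩
  ∑ (allVects n) (λ b → 𝟙 (p (false ∷ b)))          ≤⟨ m≤m+n _ _ ⟩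
  ∑ allBools (λ a → ∑ (allVects n) (λ b → 𝟙 (p (a ∷ b))))  ≡⟨ ∑-allVec-suc (λ b → 𝟙 (p b)) allBools ⟨
  ∑ (allVects (suc n)) (λ b → 𝟙 (p b))             ≡⟨ count≡∑𝟙 p (allVects (suc n)) ⟨
  count p (allVects (suc n))                        ∎
  where open ≤-Reasoning

count-false : (xs : List A) → count (λ _ → false) xs ≡ 0
count-false []       = refl
count-false (x ∷ xs) = count-false xs

count-∧-fibres : ∀ {ℓ} (P : A → Bool) (L : Vect ℓ → Bool) (F : A → Vect ℓ) (xs : List A) →
                 count (λ x → P x ∧ L (F x)) xs
                 ≡ ∑ (allVects ℓ) (λ y → 𝟙 (L y) * count (λ x → P x ∧ (F x ==v y)) xs)
count-∧-fibres {ℓ = ℓ} P L F xs = begin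
  count (λ x → P x ∧ L (F x)) xs
    ≡⟨ count≡∑𝟙 (λ x → P x ∧ L (F x)) xs ⟩
  ∑ xs (λ x → 𝟙 (P x ∧ L (F x)))
    ≡⟨ ∑-cong xs (λ x → ∑-==v ℓ (F x) (λ y → 𝟙 (P x ∧ L y))) ⟨
  ∑ xs (λ x → ∑ (allVects ℓ) (λ y → if F x ==v y then 𝟙 (P x ∧ L y) else 0))
    ≡⟨ ∑-swap (λ x y → if F x ==v y then 𝟙 (P x ∧ L y) else 0) xs (allVects ℓ) ⟩
  ∑ (allVects ℓ) (λ y → ∑ xs (λ x → if F x ==v y then 𝟙 (P x ∧ L y) else 0))
    ≡⟨ ∑-cong (allVects ℓ) (λ y → ∑-cong xs (λ x → if-𝟙-∧ (P x) (L y) (F x ==v y))) ⟩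
  ∑ (allVects ℓ) (λ y → ∑ xs (λ x → 𝟙 (L y) * 𝟙 (P x ∧ (F x ==v y))))
    ≡⟨ ∑-cong (allVects ℓ) (λ y → trans (∑-*ˡ (𝟙 (L y)) _ xs)
                                        (cong (𝟙 (L y) *_) (sym (count≡∑𝟙 (λ x → P x ∧ (F x ==v y)) xs)))) ⟩
  ∑ (allVects ℓ) (λ y → 𝟙 (L y) * count (λ x → P x ∧ (F x ==v y)) xs) ∎
  where open ≡-Reasoning

-- The graph of F

graph : ∀ {ℓ n} → (Mat ℓ n → Vect ℓ) → Mat ℓ (suc n) → Bool
graph F M′ = F (Vec.map Vec.tail M′) ==v Vec.map Vec.head M′

module _ {ℓ n : ℕ} (F : Mat ℓ n → Vect ℓ) where

  graph-⊲ : ∀ y M → graph F (y ⊲ M) ≡ F M ==v y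
  graph-⊲ y M rewrite map-head-⊲ y M | map-tail-⊲ y M = refl

  ∑-graph : (h : Mat ℓ (suc n) → ℕ) →
            ∑ (allMats ℓ (suc n)) (λ M′ → if graph F M′ then h M′ else 0)
            ≡ ∑ (allMats ℓ n) (λ M → h (F M ⊲ M))
  ∑-graph h = trans (∑-allMats-suc ℓ n (λ M′ → if graph F M′ then h M′ else 0)) (∑-cong (allMats ℓ n) (λ M →
    trans (∑-cong (allVects ℓ) (λ y → cong (λ c → if c then h (y ⊲ M) else 0) (graph-⊲ y M)))
          (∑-==v ℓ (F M) (λ y → h (y ⊲ M)))))

  card-graph : card (graph F) ≡ 2 ^ (ℓ * n)
  card-graph = begin
    card (graph F)                                         ≡⟨ count≡∑𝟙 (graph F) (allMats ℓ (suc n)) ⟩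
    ∑ (allMats ℓ (suc n)) (λ M′ → 𝟙 (graph F M′))          ≡⟨ ∑-graph (λ _ → 1) ⟩
    ∑ (allMats ℓ n) (λ _ → 1)                              ≡⟨ ∑-1≡length (allMats ℓ n) ⟩
    length (allMats ℓ n)                                   ≡⟨ length-allMats ℓ n ⟩
    2 ^ (ℓ * n)                                            ∎
    where open ≡-Reasoning

  card-graph-∧ : (P : Mat ℓ (suc n) → Bool) →
                 card (λ M′ → graph F M′ ∧ P M′) ≡ card (λ M → P (F M ⊲ M))
  card-graph-∧ P = begin
    card (λ M′ → graph F M′ ∧ P M′)
      ≡⟨ count≡∑𝟙 (λ M′ → graph F M′ ∧ P M′) (allMats ℓ (suc n)) ⟩
    ∑ (allMats ℓ (suc n)) (λ M′ → 𝟙 (graph F M′ ∧ P M′))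
      ≡⟨ ∑-cong (allMats ℓ (suc n)) (λ M′ → 𝟙-∧ (graph F M′) (P M′)) ⟩
    ∑ (allMats ℓ (suc n)) (λ M′ → if graph F M′ then 𝟙 (P M′) else 0)
      ≡⟨ ∑-graph (λ M′ → 𝟙 (P M′)) ⟩
    ∑ (allMats ℓ n) (λ M → 𝟙 (P (F M ⊲ M)))
      ≡⟨ count≡∑𝟙 (λ M → P (F M ⊲ M)) (allMats ℓ n) ⟨
    card (λ M → P (F M ⊲ M)) ∎
    where open ≡-Reasoning

  agreeCount≤shortcodeHits-graph : agreeCount F ≤ shortcodeHits (graph F)
  agreeCount≤shortcodeHits-graph = begin
    agreeCount F
      ≤⟨ ∑-mono (All.universal (λ M → ∑-mono (All.universal (λ a → agree≤hits M a) (allVects ℓ))) (allMats ℓ n)) ⟩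
    ∑ (allMats ℓ n) (λ M → hits (F M ⊲ M))
      ≡⟨ ∑-graph hits ⟨
    shortcodeHits (graph F) ∎
    where
    open ≤-Reasoning
    hits : Mat ℓ (suc n) → ℕ
    hits M′ = ∑ (allVects ℓ) (λ a → count (λ b′ → graph F (M′ +M outer a b′)) (allVects (suc n)))
    agree≤hits : ∀ M a → count (λ b → F (M +M outer a b) ==v F M) (allVects n)
                         ≤ count (λ b′ → graph F ((F M ⊲ M) +M outer a b′)) (allVects (suc n))
    agree≤hits M a = ≤-trans
      (≤-reflexive (count-cong (allVects n) (λ b → sym (trans (cong (graph F) (⊲-+M-outer (F M) a M b))
                                                               (graph-⊲ (F M) (M +M outer a b))))))
      (count-head-false≤count (λ b′ → graph F ((F M ⊲ M) +M outer a b′)))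

graph-shortcodeHits-dense : ∀ η {ℓ n} (F : Mat ℓ n → Vect ℓ) →
  η *ℚ toℚ (2 ^ (ℓ * n) * 2 ^ ℓ * 2 ^ n) ≤ℚ toℚ (agreeCount F) →
  η *ℚ ½ *ℚ toℚ (card (graph F) * 2 ^ ℓ * 2 ^ suc n) ≤ℚ toℚ (shortcodeHits (graph F))
graph-shortcodeHits-dense η {ℓ} {n} F agree = begin
  η *ℚ ½ *ℚ toℚ (card (graph F) * 2 ^ ℓ * 2 ^ suc n)
    ≡⟨ cong (λ k → η *ℚ ½ *ℚ toℚ (k * 2 ^ ℓ * 2 ^ suc n)) (card-graph F) ⟩
  η *ℚ ½ *ℚ toℚ (2 ^ (ℓ * n) * 2 ^ ℓ * (2 * 2 ^ n))
    ≡⟨ cong (λ k → η *ℚ ½ *ℚ toℚ k) (*-left-commute (2 ^ (ℓ * n) * 2 ^ ℓ) 2 (2 ^ n)) ⟩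
  η *ℚ ½ *ℚ toℚ (2 * (2 ^ (ℓ * n) * 2 ^ ℓ * 2 ^ n))
    ≡⟨ ½-*-toℚ-double η (2 ^ (ℓ * n) * 2 ^ ℓ * 2 ^ n) ⟩
  η *ℚ toℚ (2 ^ (ℓ * n) * 2 ^ ℓ * 2 ^ n)
    ≤⟨ agree ⟩
  toℚ (agreeCount F)
    ≤⟨ toℚ-mono-≤ (agreeCount≤shortcodeHits-graph F) ⟩
  toℚ (shortcodeHits (graph F)) ∎
  where open ℚ.≤-Reasoning

∧-congˡ-when : ∀ {a b c} → (a ≡ true → b ≡ c) → a ∧ b ≡ a ∧ c
∧-congˡ-when {false} b≡c = refl
∧-congˡ-when {true}  b≡c = b≡c refl

allB-++ : ∀ {k m} (bs : Vec Bool k) (cs : Vec Bool m) → allB (bs Vec.++ cs) ≡ allB bs ∧ allB cs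
allB-++ []       cs = refl
allB-++ (b ∷ bs) cs = trans (cong (b ∧_) (allB-++ bs cs)) (sym (∧-assoc b (allB bs) (allB cs)))

allB-replicate-true : ∀ k → allB (Vec.replicate k true) ≡ true
allB-replicate-true zero    = refl
allB-replicate-true (suc k) = allB-replicate-true k

module _ {C D : Set} where

  allB-zipWith-cong : ∀ {k} {f g : C → D → Bool} (xs : Vec C k) (ys : Vec D k) →
                      (∀ x y → f x y ≡ g x y) → allB (Vec.zipWith f xs ys) ≡ allB (Vec.zipWith g xs ys)
  allB-zipWith-cong []       []       f≗g = refl
  allB-zipWith-cong (x ∷ xs) (y ∷ ys) f≗g = cong₂ _∧_ (f≗g x y) (allB-zipWith-cong xs ys f≗g)

  allB-zipWith-congᴬ : ∀ {k} {P : C → Set} {f g : C → D → Bool} {xs : Vec C k} (ys : Vec D k) →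
                       VecAll.All P xs → (∀ {x} y → P x → f x y ≡ g x y) →
                       allB (Vec.zipWith f xs ys) ≡ allB (Vec.zipWith g xs ys)
  allB-zipWith-congᴬ []       VecAll.[]           f≗g = refl
  allB-zipWith-congᴬ (y ∷ ys) (px VecAll.∷ pxs) f≗g = cong₂ _∧_ (f≗g y px) (allB-zipWith-congᴬ ys pxs f≗g)

  allB-zipWith-cong-when : ∀ {k} {h f g : C → D → Bool} (xs : Vec C k) (ys : Vec D k) →
                           (∀ x y → h x y ≡ true → f x y ≡ g x y) → allB (Vec.zipWith h xs ys) ≡ true →
                           allB (Vec.zipWith f xs ys) ≡ allB (Vec.zipWith g xs ys)
  allB-zipWith-cong-when []       []       f≗g _   = refl
  allB-zipWith-cong-when (x ∷ xs) (y ∷ ys) f≗g all = cong₂ _∧_ (f≗g x y (∧-conicalˡ _ _ all))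
                                                             (allB-zipWith-cong-when xs ys f≗g (∧-conicalʳ _ _ all))

  allB-zipWith-∧ : ∀ {k} (f g : C → D → Bool) (xs : Vec C k) (ys : Vec D k) →
                   allB (Vec.zipWith (λ x y → f x y ∧ g x y) xs ys)
                   ≡ allB (Vec.zipWith f xs ys) ∧ allB (Vec.zipWith g xs ys)
  allB-zipWith-∧ f g []       []       = refl
  allB-zipWith-∧ f g (x ∷ xs) (y ∷ ys) =
    trans (cong ((f x y ∧ g x y) ∧_) (allB-zipWith-∧ f g xs ys)) (∧-interchange (f x y) (g x y) _ _)

  allB-zipWith-lookup : ∀ {k} (f : C → D → Bool) (xs : Vec C k) (ys : Vec D k) (i : Fin k) →
                        f (Vec.lookup xs i) (Vec.lookup ys i) ≡ false → allB (Vec.zipWith f xs ys) ≡ false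
  allB-zipWith-lookup f (x ∷ xs) (y ∷ ys) zero    fxy≡false = cong (_∧ allB (Vec.zipWith f xs ys)) fxy≡false
  allB-zipWith-lookup f (x ∷ xs) (y ∷ ys) (suc i) rest≡false =
    trans (cong (f x y ∧_) (allB-zipWith-lookup f xs ys i rest≡false)) (∧-zeroʳ (f x y))

zipWith-map-zipWith : ∀ {C D E G H : Set} {k} (f : E → G → H) (g : C → E) (h : C → D → G)
                      (xs : Vec C k) (ys : Vec D k) →
                      Vec.zipWith f (Vec.map g xs) (Vec.zipWith h xs ys) ≡ Vec.zipWith (λ x y → f (g x) (h x y)) xs ys
zipWith-map-zipWith f g h []       []       = refl
zipWith-map-zipWith f g h (x ∷ xs) (y ∷ ys) = cong (_ ∷_) (zipWith-map-zipWith f g h xs ys)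

satisfiesRight : ∀ {ℓ n k} → Vec (Vect n) k → Vec (Vect ℓ) k → Mat ℓ n → Bool
satisfiesRight qs ts M = allB (Vec.zipWith (λ q t → (M ·v q) ==v t) qs ts)

satisfiesLeft : ∀ {ℓ n k} → Vec (Vect ℓ) k → Vec (Vect n) k → Mat ℓ n → Bool
satisfiesLeft ss us M = allB (Vec.zipWith (λ s u → (s ᵀ· M) ==v u) ss us)

module _ {ℓ n : ℕ} (M : Mat ℓ n) where

  satisfiesRight-++ : ∀ {k m} (qs : Vec (Vect n) k) (qs′ : Vec (Vect n) m) ts ts′ →
                      satisfiesRight (qs Vec.++ qs′) (ts Vec.++ ts′) M ≡ satisfiesRight qs ts M ∧ satisfiesRight qs′ ts′ M
  satisfiesRight-++ qs qs′ ts ts′ = trans (cong allB (Vec.zipWith-++ entry qs qs′ ts ts′))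
                                          (allB-++ (Vec.zipWith entry qs ts) (Vec.zipWith entry qs′ ts′))
    where
    entry : Vect n → Vect ℓ → Bool
    entry q t = (M ·v q) ==v t

  satisfiesLeft-++ : ∀ {k m} (ss : Vec (Vect ℓ) k) (ss′ : Vec (Vect ℓ) m) us us′ →
                     satisfiesLeft (ss Vec.++ ss′) (us Vec.++ us′) M ≡ satisfiesLeft ss us M ∧ satisfiesLeft ss′ us′ M
  satisfiesLeft-++ ss ss′ us us′ = trans (cong allB (Vec.zipWith-++ entry ss ss′ us us′))
                                         (allB-++ (Vec.zipWith entry ss us) (Vec.zipWith entry ss′ us′))
    where
    entry : Vect ℓ → Vect n → Bool
    entry s u = (s ᵀ· M) ==v u

  satisfiesRight-zeroV : ∀ k → satisfiesRight (Vec.replicate k zeroV) (Vec.replicate k zeroV) M ≡ true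
  satisfiesRight-zeroV k = begin
    satisfiesRight (Vec.replicate k zeroV) (Vec.replicate k zeroV) M
      ≡⟨ cong allB (Vec.zipWith-replicate {n = k} (λ q t → (M ·v q) ==v t) zeroV zeroV) ⟩
    allB (Vec.replicate k ((M ·v zeroV) ==v zeroV))    ≡⟨ cong (λ v → allB (Vec.replicate k (v ==v zeroV))) (·v-zeroV M) ⟩
    allB (Vec.replicate k (zeroV ==v zeroV))           ≡⟨ cong (λ b → allB (Vec.replicate k b)) (==v-refl zeroV) ⟩
    allB (Vec.replicate k true)                        ≡⟨ allB-replicate-true k ⟩
    true                                               ∎
    where open ≡-Reasoning

  satisfiesLeft-zeroV : ∀ k → satisfiesLeft (Vec.replicate k zeroV) (Vec.replicate k zeroV) M ≡ true
  satisfiesLeft-zeroV k = begin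
    satisfiesLeft (Vec.replicate k zeroV) (Vec.replicate k zeroV) M
      ≡⟨ cong allB (Vec.zipWith-replicate {n = k} (λ s u → (s ᵀ· M) ==v u) zeroV zeroV) ⟩
    allB (Vec.replicate k ((zeroV ᵀ· M) ==v zeroV))    ≡⟨ cong (λ v → allB (Vec.replicate k (v ==v zeroV))) (zeroVᵀ· M) ⟩
    allB (Vec.replicate k (zeroV ==v zeroV))           ≡⟨ cong (λ b → allB (Vec.replicate k b)) (==v-refl zeroV) ⟩
    allB (Vec.replicate k true)                        ≡⟨ allB-replicate-true k ⟩
    true                                               ∎
    where open ≡-Reasoning

-- Padding with the trivial constraints M 0 = 0 and 0ᵀ M = 0ᵀ.
nice⇒condEvent : ∀ {ℓ n r} k (T : NiceData ℓ n r) →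
  Σ (Vec (Vect n) (k + r)) λ qs → Σ (Vec (Vect ℓ) (k + r)) λ ts →
  Σ (Vec (Vect ℓ) (k + r)) λ ps → Σ (Vec (Vect n) (k + r)) λ ss →
    ∀ M → condEvent qs ts ps ss M ≡ inNice T M
nice⇒condEvent {ℓ} {n} k record { r₁ = r₁ ; r₂ = r₂ ; sumEq = refl ; qs = qs ; ts = ts ; ss = ss ; us = us } =
  zeros k Vec.++ (qs Vec.++ zeros r₂) , zeros k Vec.++ (ts Vec.++ zeros r₂) ,
  zeros k Vec.++ (zeros r₁ Vec.++ ss) , zeros k Vec.++ (zeros r₁ Vec.++ us) , padded≡
  where
  zeros : ∀ {m} j → Vec (Vect m) j
  zeros j = Vec.replicate j zeroV
  padded≡ : ∀ M → condEvent (zeros k Vec.++ (qs Vec.++ zeros r₂)) (zeros k Vec.++ (ts Vec.++ zeros r₂))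
                            (zeros k Vec.++ (zeros r₁ Vec.++ ss)) (zeros k Vec.++ (zeros r₁ Vec.++ us)) M
                  ≡ satisfiesRight qs ts M ∧ satisfiesLeft ss us M
  padded≡ M = cong₂ _∧_
    (begin
      satisfiesRight (zeros k Vec.++ (qs Vec.++ zeros r₂)) (zeros k Vec.++ (ts Vec.++ zeros r₂)) M
        ≡⟨ satisfiesRight-++ M (zeros k) _ (zeros k) _ ⟩
      satisfiesRight (zeros k) (zeros k) M ∧ satisfiesRight (qs Vec.++ zeros r₂) (ts Vec.++ zeros r₂) M
        ≡⟨ cong₂ _∧_ (satisfiesRight-zeroV M k) (satisfiesRight-++ M qs (zeros r₂) ts (zeros r₂)) ⟩
      satisfiesRight qs ts M ∧ satisfiesRight (zeros r₂) (zeros r₂) M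
        ≡⟨ trans (cong (satisfiesRight qs ts M ∧_) (satisfiesRight-zeroV M r₂)) (∧-identityʳ _) ⟩
      satisfiesRight qs ts M ∎)
    (begin
      satisfiesLeft (zeros k Vec.++ (zeros r₁ Vec.++ ss)) (zeros k Vec.++ (zeros r₁ Vec.++ us)) M
        ≡⟨ satisfiesLeft-++ M (zeros k) _ (zeros k) _ ⟩
      satisfiesLeft (zeros k) (zeros k) M ∧ satisfiesLeft (zeros r₁ Vec.++ ss) (zeros r₁ Vec.++ us) M
        ≡⟨ cong₂ _∧_ (satisfiesLeft-zeroV M k) (satisfiesLeft-++ M (zeros r₁) ss (zeros r₁) us) ⟩
      satisfiesLeft (zeros r₁) (zeros r₁) M ∧ satisfiesLeft ss us M
        ≡⟨ cong (_∧ satisfiesLeft ss us M) (satisfiesLeft-zeroV M r₁) ⟩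
      satisfiesLeft ss us M ∎)
    where open ≡-Reasoning

-- On the set where the first column equals M z + u, a right constraint (c ∷ q, t) on the
-- whole matrix becomes the constraint (q + c z, t + c u) on its last n columns.
module _ {ℓ n : ℕ} (z : Vect n) (u : Vect ℓ) where

  restrictQ : Vect (suc n) → Vect n
  restrictQ q = Vec.tail q +v (if Vec.head q then z else zeroV)

  restrictT : Vect (suc n) → Vect ℓ → Vect ℓ
  restrictT q t = t +v (if Vec.head q then u else zeroV)

  ==v-restrict-false : ∀ y (M : Mat ℓ n) q t →
                       ((y ⊲ M) ·v (false ∷ q)) ==v t ≡ (M ·v restrictQ (false ∷ q)) ==v restrictT (false ∷ q) t
  ==v-restrict-false y M q t =
    cong₂ _==v_ (trans (⊲-·v-false y M q) (cong (M ·v_) (sym (+v-identityʳ q)))) (sym (+v-identityʳ t))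

  ==v-restrict-affine : ∀ (M : Mat ℓ n) q t →
                        ((((M ·v z) +v u) ⊲ M) ·v q) ==v t ≡ (M ·v restrictQ q) ==v restrictT q t
  ==v-restrict-affine M (false ∷ q) t = ==v-restrict-false ((M ·v z) +v u) M q t
  ==v-restrict-affine M (true ∷ q)  t = begin
    ((((M ·v z) +v u) ⊲ M) ·v (true ∷ q)) ==v t  ≡⟨ cong (_==v t) (⊲-·v-true ((M ·v z) +v u) M q) ⟩
    (((M ·v z) +v u) +v (M ·v q)) ==v t          ≡⟨ ==v-⇔ to from ⟩
    ((M ·v q) +v (M ·v z)) ==v (t +v u)          ≡⟨ cong (_==v (t +v u)) (·v-+v M q z) ⟨
    (M ·v (q +v z)) ==v (t +v u)                 ∎
    where
    open ≡-Reasoning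
    to : ((M ·v z) +v u) +v (M ·v q) ≡ t → (M ·v q) +v (M ·v z) ≡ t +v u
    to e = +v-transposeʳ (trans (sym (+v-rotate (M ·v z) u (M ·v q))) e)
    from : (M ·v q) +v (M ·v z) ≡ t +v u → ((M ·v z) +v u) +v (M ·v q) ≡ t
    from e = trans (+v-rotate (M ·v z) u (M ·v q)) (trans (cong (_+v u) e) (+v-involutiveʳ t u))

FirstColumnUsed : ∀ {n k} → Vec (Vect (suc n)) k → Set
FirstColumnUsed {n} {k} qs = Σ (Fin k) λ i → Σ (Vect n) λ z → Vec.lookup qs i ≡ true ∷ z

FirstColumnUnused : ∀ {n k} → Vec (Vect (suc n)) k → Set
FirstColumnUnused = VecAll.All (λ q → Vec.head q ≡ false)

restrict : ∀ {ℓ n r} → NiceData ℓ (suc n) r → Vect n → Vect ℓ → NiceData ℓ n r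
restrict T z u = record
  { r₁ = r₁ ; r₂ = r₂ ; sumEq = sumEq
  ; qs = Vec.map (restrictQ z u) qs ; ts = Vec.zipWith (restrictT z u) qs ts
  ; ss = ss ; us = Vec.map Vec.tail us }
  where open NiceData T

leftOnFirstColumn : ∀ {ℓ n k} → Vec (Vect ℓ) k → Vec (Vect (suc n)) k → Vect ℓ → Bool
leftOnFirstColumn ss us y = allB (Vec.zipWith (λ s u → ⌊ dot s y ≟B Vec.head u ⌋) ss us)

module _ {ℓ n r : ℕ} (T : NiceData ℓ (suc n) r) where
  open NiceData T

  satisfiesLeft-⊲ : ∀ y M → satisfiesLeft ss us (y ⊲ M)
                            ≡ leftOnFirstColumn ss us y ∧ satisfiesLeft ss (Vec.map Vec.tail us) M
  satisfiesLeft-⊲ y M = begin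
    satisfiesLeft ss us (y ⊲ M)
      ≡⟨ allB-zipWith-cong ss us split ⟩
    allB (Vec.zipWith (λ s u → ⌊ dot s y ≟B Vec.head u ⌋ ∧ ((s ᵀ· M) ==v Vec.tail u)) ss us)
      ≡⟨ allB-zipWith-∧ (λ s u → ⌊ dot s y ≟B Vec.head u ⌋) (λ s u → (s ᵀ· M) ==v Vec.tail u) ss us ⟩
    leftOnFirstColumn ss us y ∧ allB (Vec.zipWith (λ s u → (s ᵀ· M) ==v Vec.tail u) ss us)
      ≡⟨ cong (λ v → leftOnFirstColumn ss us y ∧ allB v) (Vec.zipWith-map₂ (λ s u → (s ᵀ· M) ==v u) Vec.tail ss us) ⟨
    leftOnFirstColumn ss us y ∧ satisfiesLeft ss (Vec.map Vec.tail us) M ∎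
    where
    open ≡-Reasoning
    split : ∀ s u → (s ᵀ· (y ⊲ M)) ==v u ≡ ⌊ dot s y ≟B Vec.head u ⌋ ∧ ((s ᵀ· M) ==v Vec.tail u)
    split s (d ∷ u) = trans (cong (_==v (d ∷ u)) (ᵀ·-⊲ s y M)) (==v-∷ (dot s y) d (s ᵀ· M) u)

  inNice-⊲-restrict : ∀ z u y M →
    satisfiesRight qs ts (y ⊲ M) ≡ allB (Vec.zipWith (λ q t → (M ·v restrictQ z u q) ==v restrictT z u q t) qs ts) →
    inNice T (y ⊲ M) ≡ inNice (restrict T z u) M ∧ leftOnFirstColumn ss us y
  inNice-⊲-restrict z u y M right≡ = begin
    satisfiesRight qs ts (y ⊲ M) ∧ satisfiesLeft ss us (y ⊲ M)
      ≡⟨ cong₂ _∧_ (trans right≡ (sym (cong allB restricted-entries))) (satisfiesLeft-⊲ y M) ⟩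
    R′ ∧ (leftOnFirstColumn ss us y ∧ L′)
      ≡⟨ x∙yz≈xz∙y R′ (leftOnFirstColumn ss us y) L′ ⟩
    (R′ ∧ L′) ∧ leftOnFirstColumn ss us y ∎
    where
    open ≡-Reasoning
    restricted-entries : Vec.zipWith (λ q t → (M ·v q) ==v t) (Vec.map (restrictQ z u) qs) (Vec.zipWith (restrictT z u) qs ts)
                         ≡ Vec.zipWith (λ q t → (M ·v restrictQ z u q) ==v restrictT z u q t) qs ts
    restricted-entries = zipWith-map-zipWith (λ q t → (M ·v q) ==v t) (restrictQ z u) (restrictT z u) qs ts
    R′ L′ : Bool
    R′ = satisfiesRight (Vec.map (restrictQ z u) qs) (Vec.zipWith (restrictT z u) qs ts) M
    L′ = satisfiesLeft ss (Vec.map Vec.tail us) M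

  inNice-⊲-affine : ∀ z u M →
    inNice T (((M ·v z) +v u) ⊲ M) ≡ inNice (restrict T z u) M ∧ leftOnFirstColumn ss us ((M ·v z) +v u)
  inNice-⊲-affine z u M = inNice-⊲-restrict z u ((M ·v z) +v u) M (allB-zipWith-cong qs ts (==v-restrict-affine z u M))

  inNice-⊲-unused : FirstColumnUnused qs → ∀ z u y M →
                    inNice T (y ⊲ M) ≡ inNice (restrict T z u) M ∧ leftOnFirstColumn ss us y
  inNice-⊲-unused unused z u y M = inNice-⊲-restrict z u y M (allB-zipWith-congᴬ ts unused entry)
    where
    entry : ∀ {q} t → Vec.head q ≡ false → ((y ⊲ M) ·v q) ==v t ≡ (M ·v restrictQ z u q) ==v restrictT z u q t
    entry {false ∷ q} t refl = ==v-restrict-false z u y M q t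

-- Nice sets meeting the graph

AffineOnNiceSet : ∀ {ℓ n} → ℕ → ℚ → (Mat ℓ n → Vect ℓ) → Set
AffineOnNiceSet {ℓ} {n} r δ F =
  Σ (NiceData ℓ n r) λ T → Σ (Vect n) λ z → Σ (Vect ℓ) λ u →
    (1 ≤ card (inNice T)) ×
    (δ *ℚ toℚ (card (inNice T)) ≤ℚ toℚ (card (λ M → inNice T M ∧ (F M ==v ((M ·v z) +v u)))))

module AffineFirstColumn {ℓ n r} (F : Mat ℓ n → Vect ℓ) (δ : ℚ) (T : NiceData ℓ (suc n) r)
                         (i : Fin (NiceData.r₁ T)) (z : Vect n) (qᵢ≡ : Vec.lookup (NiceData.qs T) i ≡ true ∷ z) where
  open NiceData T

  u : Vect ℓ
  u = Vec.lookup ts i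

  w : Mat ℓ n → Vect ℓ
  w M = (M ·v z) +v u

  T′ : NiceData ℓ n r
  T′ = restrict T z u

  -- T's left constraints on the first column, evaluated at M z + u once the others hold.
  leftOnAffineColumn : Bool
  leftOnAffineColumn = allB (Vec.zipWith (λ s u′ → ⌊ (dot (Vec.tail u′) z xor dot s u) ≟B Vec.head u′ ⌋) ss us)

  inNice-⊲-w : ∀ y M → inNice T (y ⊲ M) ≡ (w M ==v y) ∧ inNice T (w M ⊲ M)
  inNice-⊲-w y M with w M ==v y in wM==y
  ... | true  = cong (λ v → inNice T (v ⊲ M)) (sym (==v⇒≡ wM==y))
  ... | false = cong (_∧ satisfiesLeft ss us (y ⊲ M))
                     (allB-zipWith-lookup (λ q t → ((y ⊲ M) ·v q) ==v t) qs ts i ith-fails)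
    where
    ith-fails : ((y ⊲ M) ·v Vec.lookup qs i) ==v u ≡ false
    ith-fails = begin
      ((y ⊲ M) ·v Vec.lookup qs i) ==v u  ≡⟨ cong (λ q → ((y ⊲ M) ·v q) ==v u) qᵢ≡ ⟩
      ((y ⊲ M) ·v (true ∷ z)) ==v u      ≡⟨ cong (_==v u) (⊲-·v-true y M z) ⟩
      (y +v (M ·v z)) ==v u              ≡⟨ ==v-⇔ (λ e → trans (+v-comm (M ·v z) u) (sym (+v-transposeʳ e)))
                                                  (λ e → sym (+v-transposeʳ (trans (+v-comm u (M ·v z)) e))) ⟩
      w M ==v y                          ≡⟨ wM==y ⟩
      false                              ∎
      where open ≡-Reasoning

  leftOnFirstColumn-w : ∀ M → satisfiesLeft ss (Vec.map Vec.tail us) M ≡ true →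
                        leftOnFirstColumn ss us (w M) ≡ leftOnAffineColumn
  leftOnFirstColumn-w M left′ = allB-zipWith-cong-when ss us first-entry
    (trans (sym (cong allB (Vec.zipWith-map₂ (λ s u′ → (s ᵀ· M) ==v u′) Vec.tail ss us))) left′)
    where
    first-entry : ∀ s u′ → (s ᵀ· M) ==v Vec.tail u′ ≡ true →
                  ⌊ dot s (w M) ≟B Vec.head u′ ⌋ ≡ ⌊ (dot (Vec.tail u′) z xor dot s u) ≟B Vec.head u′ ⌋
    first-entry s u′ sM==u′ = cong (λ b → ⌊ b ≟B Vec.head u′ ⌋) (begin
      dot s ((M ·v z) +v u)           ≡⟨ dot-+vʳ s (M ·v z) u ⟩
      dot s (M ·v z) xor dot s u      ≡⟨ cong (_xor dot s u) (dot-ᵀ·-·v s M z) ⟩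
      dot (s ᵀ· M) z xor dot s u      ≡⟨ cong (λ v → dot v z xor dot s u) (==v⇒≡ sM==u′) ⟩
      dot (Vec.tail u′) z xor dot s u ∎)
      where open ≡-Reasoning

  inNice-w : ∀ M → inNice T (w M ⊲ M) ≡ inNice T′ M ∧ leftOnAffineColumn
  inNice-w M = trans (inNice-⊲-affine T z u M)
                     (∧-congˡ-when (λ T′M → leftOnFirstColumn-w M (∧-conicalʳ _ _ T′M)))

  card-T : card (inNice T) ≡ card (λ M → inNice T′ M ∧ leftOnAffineColumn)
  card-T = begin
    card (inNice T)
      ≡⟨ card-⊲ (inNice T) ⟩
    ∑ (allMats ℓ n) (λ M → ∑ (allVects ℓ) (λ y → 𝟙 (inNice T (y ⊲ M))))
      ≡⟨ ∑-cong (allMats ℓ n) (λ M → ∑-cong (allVects ℓ) (λ y →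
           trans (cong 𝟙 (inNice-⊲-w y M)) (𝟙-∧ (w M ==v y) (inNice T (w M ⊲ M))))) ⟩
    ∑ (allMats ℓ n) (λ M → ∑ (allVects ℓ) (λ y → if w M ==v y then 𝟙 (inNice T (w M ⊲ M)) else 0))
      ≡⟨ ∑-cong (allMats ℓ n) (λ M → ∑-==v ℓ (w M) (λ _ → 𝟙 (inNice T (w M ⊲ M)))) ⟩
    ∑ (allMats ℓ n) (λ M → 𝟙 (inNice T (w M ⊲ M)))
      ≡⟨ count≡∑𝟙 (λ M → inNice T (w M ⊲ M)) (allMats ℓ n) ⟨
    card (λ M → inNice T (w M ⊲ M))
      ≡⟨ count-cong (allMats ℓ n) inNice-w ⟩
    card (λ M → inNice T′ M ∧ leftOnAffineColumn) ∎
    where open ≡-Reasoning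

  card-graph∩T : card (λ M′ → graph F M′ ∧ inNice T M′)
                 ≡ card (λ M → (w M ==v F M) ∧ (inNice T′ M ∧ leftOnAffineColumn))
  card-graph∩T = trans (card-graph-∧ F (inNice T)) (count-cong (allMats ℓ n) (λ M →
    trans (inNice-⊲-w (F M) M) (cong ((w M ==v F M) ∧_) (inNice-w M))))

  leftOnAffineColumn≡true : 1 ≤ card (inNice T) → leftOnAffineColumn ≡ true
  leftOnAffineColumn≡true T≢∅ with leftOnAffineColumn in eq
  ... | true  = refl
  ... | false = contradiction (subst (1 ≤_) T≡∅ T≢∅) λ ()
    where
    T≡∅ : card (inNice T) ≡ 0
    T≡∅ = trans card-T (trans (count-cong (allMats ℓ n) (λ M →
            trans (cong (inNice T′ M ∧_) eq) (∧-zeroʳ (inNice T′ M)))) (count-false (allMats ℓ n)))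

  affineOnNiceSet : 1 ≤ card (inNice T) →
                    δ *ℚ toℚ (card (inNice T)) ≤ℚ toℚ (card (λ M′ → graph F M′ ∧ inNice T M′)) →
                    AffineOnNiceSet r δ F
  affineOnNiceSet T≢∅ dense = T′ , z , u , subst (1 ≤_) T≡T′ T≢∅ ,
    subst₂ (λ a b → δ *ℚ toℚ a ≤ℚ toℚ b) T≡T′ graph∩T≡ dense
    where
    consistent : leftOnAffineColumn ≡ true
    consistent = leftOnAffineColumn≡true T≢∅
    T≡T′ : card (inNice T) ≡ card (inNice T′)
    T≡T′ = trans card-T (count-cong (allMats ℓ n) (λ M →
             trans (cong (inNice T′ M ∧_) consistent) (∧-identityʳ (inNice T′ M))))
    graph∩T≡ : card (λ M′ → graph F M′ ∧ inNice T M′) ≡ card (λ M → inNice T′ M ∧ (F M ==v w M))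
    graph∩T≡ = trans card-graph∩T (count-cong (allMats ℓ n) (λ M → begin
      (w M ==v F M) ∧ (inNice T′ M ∧ leftOnAffineColumn)
        ≡⟨ cong (λ b → (w M ==v F M) ∧ (inNice T′ M ∧ b)) consistent ⟩
      (w M ==v F M) ∧ (inNice T′ M ∧ true)
        ≡⟨ cong₂ _∧_ (==v-sym (w M) (F M)) (∧-identityʳ (inNice T′ M)) ⟩
      (F M ==v w M) ∧ inNice T′ M
        ≡⟨ ∧-comm (F M ==v w M) (inNice T′ M) ⟩
      inNice T′ M ∧ (F M ==v w M) ∎))
      where open ≡-Reasoning

module FreeFirstColumn {ℓ n r} (F : Mat ℓ n → Vect ℓ) (δ : ℚ) (T : NiceData ℓ (suc n) r)
                       (unused : FirstColumnUnused (NiceData.qs T)) where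
  open NiceData T

  T′ : NiceData ℓ n r
  T′ = restrict T zeroV zeroV

  columns : ℕ
  columns = count (leftOnFirstColumn ss us) (allVects ℓ)

  fibre : Vect ℓ → ℕ
  fibre y = card (λ M → inNice T′ M ∧ (F M ==v y))

  popular : Vect ℓ
  popular = argmax fibre zeroV (allVects ℓ)

  inNice-⊲ : ∀ y M → inNice T (y ⊲ M) ≡ inNice T′ M ∧ leftOnFirstColumn ss us y
  inNice-⊲ = inNice-⊲-unused T unused zeroV zeroV

  card-T : card (inNice T) ≡ card (inNice T′) * columns
  card-T = begin
    card (inNice T)
      ≡⟨ card-⊲ (inNice T) ⟩
    ∑ (allMats ℓ n) (λ M → ∑ (allVects ℓ) (λ y → 𝟙 (inNice T (y ⊲ M))))
      ≡⟨ ∑-cong (allMats ℓ n) (λ M → ∑-cong (allVects ℓ) (λ y →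
           trans (cong 𝟙 (inNice-⊲ y M)) (𝟙-∧-* (inNice T′ M) (leftOnFirstColumn ss us y)))) ⟩
    ∑ (allMats ℓ n) (λ M → ∑ (allVects ℓ) (λ y → 𝟙 (inNice T′ M) * 𝟙 (leftOnFirstColumn ss us y)))
      ≡⟨ ∑-cong (allMats ℓ n) (λ M → trans (∑-*ˡ (𝟙 (inNice T′ M)) _ (allVects ℓ))
           (cong (𝟙 (inNice T′ M) *_) (sym (count≡∑𝟙 (leftOnFirstColumn ss us) (allVects ℓ))))) ⟩
    ∑ (allMats ℓ n) (λ M → 𝟙 (inNice T′ M) * columns)
      ≡⟨ ∑-*ʳ columns (λ M → 𝟙 (inNice T′ M)) (allMats ℓ n) ⟩
    ∑ (allMats ℓ n) (λ M → 𝟙 (inNice T′ M)) * columns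
      ≡⟨ cong (_* columns) (count≡∑𝟙 (inNice T′) (allMats ℓ n)) ⟨
    card (inNice T′) * columns ∎
    where open ≡-Reasoning

  card-graph∩T≤ : card (λ M′ → graph F M′ ∧ inNice T M′) ≤ columns * fibre popular
  card-graph∩T≤ = begin
    card (λ M′ → graph F M′ ∧ inNice T M′)
      ≡⟨ card-graph-∧ F (inNice T) ⟩
    card (λ M → inNice T (F M ⊲ M))
      ≡⟨ count-cong (allMats ℓ n) (λ M → inNice-⊲ (F M) M) ⟩
    card (λ M → inNice T′ M ∧ leftOnFirstColumn ss us (F M))
      ≡⟨ count-∧-fibres (inNice T′) (leftOnFirstColumn ss us) F (allMats ℓ n) ⟩
    ∑ (allVects ℓ) (λ y → 𝟙 (leftOnFirstColumn ss us y) * fibre y)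
      ≤⟨ ∑-mono (All.map (λ {y} → *-monoʳ-≤ (𝟙 (leftOnFirstColumn ss us y))) (f[xs]≤f[argmax] zeroV (allVects ℓ))) ⟩
    ∑ (allVects ℓ) (λ y → 𝟙 (leftOnFirstColumn ss us y) * fibre popular)
      ≡⟨ ∑-*ʳ (fibre popular) (λ y → 𝟙 (leftOnFirstColumn ss us y)) (allVects ℓ) ⟩
    ∑ (allVects ℓ) (λ y → 𝟙 (leftOnFirstColumn ss us y)) * fibre popular
      ≡⟨ cong (_* fibre popular) (count≡∑𝟙 (leftOnFirstColumn ss us) (allVects ℓ)) ⟨
    columns * fibre popular ∎
    where open ≤-Reasoning

  fibre-popular≡ : fibre popular ≡ card (λ M → inNice T′ M ∧ (F M ==v ((M ·v zeroV) +v popular)))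
  fibre-popular≡ = count-cong (allMats ℓ n) (λ M → cong (λ v → inNice T′ M ∧ (F M ==v v))
    (sym (trans (cong (_+v popular) (·v-zeroV M)) (Vec.zipWith-identityˡ (λ _ → refl) popular))))

  affineOnNiceSet : 1 ≤ card (inNice T) →
                    δ *ℚ toℚ (card (inNice T)) ≤ℚ toℚ (card (λ M′ → graph F M′ ∧ inNice T M′)) →
                    AffineOnNiceSet r δ F
  affineOnNiceSet T≢∅ dense = T′ , zeroV , popular , 1≤*⇒1≤ˡ (card (inNice T′)) columns 1≤T′*columns ,
    subst (λ k → δ *ℚ toℚ (card (inNice T′)) ≤ℚ toℚ k) fibre-popular≡
      (*-cancelʳ-≤-toℚ δ (card (inNice T′)) columns (fibre popular) (1≤*⇒1≤ʳ (card (inNice T′)) columns 1≤T′*columns)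
        (ℚ.≤-trans (subst (λ k → δ *ℚ toℚ k ≤ℚ toℚ (card (λ M′ → graph F M′ ∧ inNice T M′))) card-T dense)
                   (toℚ-mono-≤ card-graph∩T≤)))
    where
    1≤T′*columns : 1 ≤ card (inNice T′) * columns
    1≤T′*columns = subst (1 ≤_) card-T T≢∅

firstColumnUsed⊎unused : ∀ {n k} (qs : Vec (Vect (suc n)) k) → FirstColumnUsed qs ⊎ FirstColumnUnused qs
firstColumnUsed⊎unused []                = inj₂ VecAll.[]
firstColumnUsed⊎unused ((true ∷ z) ∷ qs)  = inj₁ (zero , z , refl)
firstColumnUsed⊎unused ((false ∷ _) ∷ qs) with firstColumnUsed⊎unused qs
... | inj₁ (i , z , qᵢ≡) = inj₁ (suc i , z , qᵢ≡)
... | inj₂ unused    = inj₂ (refl VecAll.∷ unused)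

nice∩graph⇒affineOnNiceSet : ∀ {ℓ n r} (F : Mat ℓ n → Vect ℓ) (δ : ℚ) (T : NiceData ℓ (suc n) r) →
  1 ≤ card (inNice T) →
  δ *ℚ toℚ (card (inNice T)) ≤ℚ toℚ (card (λ M′ → graph F M′ ∧ inNice T M′)) →
  AffineOnNiceSet r δ F
nice∩graph⇒affineOnNiceSet {ℓ} {n} {r} F δ T = by-first-column (firstColumnUsed⊎unused (NiceData.qs T))
  where
  by-first-column : FirstColumnUsed (NiceData.qs T) ⊎ FirstColumnUnused (NiceData.qs T) →
                    1 ≤ card (inNice T) →
                    δ *ℚ toℚ (card (inNice T)) ≤ℚ toℚ (card (λ M′ → graph F M′ ∧ inNice T M′)) →
                    AffineOnNiceSet r δ F
  by-first-column (inj₁ (i , z , qᵢ≡)) = AffineFirstColumn.affineOnNiceSet F δ T i z qᵢ≡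
  by-first-column (inj₂ unused)    = FreeFirstColumn.affineOnNiceSet F δ T unused

AffineOnCondition : ∀ {ℓ n} → ℕ → ℚ → (Mat ℓ n → Vect ℓ) → Set
AffineOnCondition {ℓ} {n} r δ F =
  Σ (Vec (Vect n) r) λ qs → Σ (Vec (Vect ℓ) r) λ ts →
  Σ (Vec (Vect ℓ) r) λ ps → Σ (Vec (Vect n) r) λ ss →
  Σ (Vect n) λ z → Σ (Vect ℓ) λ u →
    (1 ≤ card (condEvent qs ts ps ss)) ×
    (δ *ℚ toℚ (card (condEvent qs ts ps ss))
       ≤ℚ toℚ (card (λ M → condEvent qs ts ps ss M ∧ (F M ==v ((M ·v z) +v u)))))

affineOnNiceSet⇒affineOnCondition : ∀ {ℓ n r} δ (F : Mat ℓ n → Vect ℓ) →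
                                    AffineOnNiceSet r δ F → AffineOnCondition (suc r) δ F
affineOnNiceSet⇒affineOnCondition {ℓ} {n} {r} δ F (T , z , u , T≢∅ , dense) = padded (nice⇒condEvent 1 T)
  where
  padded : (Σ (Vec (Vect n) (suc r)) λ qs → Σ (Vec (Vect ℓ) (suc r)) λ ts →
            Σ (Vec (Vect ℓ) (suc r)) λ ps → Σ (Vec (Vect n) (suc r)) λ ss →
              ∀ M → condEvent qs ts ps ss M ≡ inNice T M) →
           AffineOnCondition (suc r) δ F
  padded (qs , ts , ps , ss , cond≡) = qs , ts , ps , ss , z , u , subst (1 ≤_) T≡C T≢∅ ,
    subst₂ (λ a b → δ *ℚ toℚ a ≤ℚ toℚ b) T≡C
           (count-cong (allMats ℓ n) (λ M → cong (_∧ (F M ==v ((M ·v z) +v u))) (sym (cond≡ M)))) dense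
    where
    T≡C : card (inNice T) ≡ card (condEvent qs ts ps ss)
    T≡C = count-cong (allMats ℓ n) (λ M → sym (cond≡ M))

InverseShortcodeBound : ℚ → ℚ → ℕ → Set
InverseShortcodeBound η δ r = (ℓ n : ℕ) (S : Mat ℓ n → Bool) →
  1 ≤ card S →
  η *ℚ toℚ (card S * 2 ^ ℓ * 2 ^ n) ≤ℚ toℚ (shortcodeHits S) →
  Σ (NiceData ℓ n r) λ T →
    (1 ≤ card (inNice T)) × (δ *ℚ toℚ (card (inNice T)) ≤ℚ toℚ (card (λ M → S M ∧ inNice T M)))

inverseShortcode⇒affineOnCondition : ∀ η δ {r} → InverseShortcodeBound (η *ℚ ½) δ r →
  ∀ {ℓ n} (F : Mat ℓ n → Vect ℓ) →
  η *ℚ toℚ (2 ^ (ℓ * n) * 2 ^ ℓ * 2 ^ n) ≤ℚ toℚ (agreeCount F) →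
  AffineOnCondition (suc r) δ F
inverseShortcode⇒affineOnCondition η δ {r} inverse {ℓ} {n} F agree =
  fromNiceSet (inverse ℓ (suc n) (graph F) graph≢∅ (graph-shortcodeHits-dense η F agree))
  where
  graph≢∅ : 1 ≤ card (graph F)
  graph≢∅ = subst (1 ≤_) (sym (card-graph F)) (m^n>0 2 (ℓ * n))
  fromNiceSet : (Σ (NiceData ℓ (suc n) r) λ T → (1 ≤ card (inNice T)) ×
                  (δ *ℚ toℚ (card (inNice T)) ≤ℚ toℚ (card (λ M′ → graph F M′ ∧ inNice T M′)))) →
                AffineOnCondition (suc r) δ F
  fromNiceSet (T , T≢∅ , dense) =
    affineOnNiceSet⇒affineOnCondition δ F (nice∩graph⇒affineOnNiceSet F δ T T≢∅ dense)

-- The threshold N is constant: the reduction works for all ℓ and n.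
mainTheorem5 : ISH → USH
mainTheorem5 ish η η>0 =
  let δ , r , δ>0 , inverse = ish (η *ℚ ½) (*½-positive η>0)
  in δ , suc r , δ>0 , s≤s z≤n , (λ _ → 0) , λ ℓ n _ → inverseShortcode⇒affineOnCondition η δ inverse
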